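{- Every prime number which is antipalindromic in base $3$ can be written as $6k+1$ for some $k\in\mathbb N$.
   Context: For $b\in\mathbb N$, $b\ge2$, write a natural number $m$ in base $b$ as $m=a_nb^n+\dots+a_1b+a_0$ with digits $a_i\in\{0,1,\dots,b-1\}$ and $a_n\neq 0$. The number $m$ is called antipalindromic in base $b$ if $a_j=b-1-a_{n-j}$ for all $j\in\{0,1,\dots,n\}$. -}

module Defs where

open import Data.Nat using (ℕ; zero; suc; _+_; _*_; _∸_; _<_)
open import Data.List using (List; []; _∷_; reverse; map; length)
open import Data.List.Relation.Unary.All using (All)
open import Data.Product using (Σ; _×_; ∃)
open import Relation.Binary.PropositionalEquality using (_≡_)
open import Relation.Nullary using (¬_)
open import Data.Maybe using (just)
open import Data.List using (last)

-- value of a digit list, least significant digit first: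
-- a₀ ∷ a₁ ∷ … ∷ aₙ ∷ [] ↦ a₀ + a₁ b + … + aₙ bⁿ
value : ℕ → List ℕ → ℕ
value b []       = 0
value b (a ∷ as) = a + b * value b as

-- ds is the base-b expansion of m: digits in {0,…,b-1}, leading digit aₙ ≠ 0
-- (for m = 0 this is the empty list, so 0 has no expansion with aₙ ≠ 0)
IsBaseExpansion : ℕ → ℕ → List ℕ → Set
IsBaseExpansion b m ds =
  All (λ a → a < b) ds × (∃ λ aₙ → last ds ≡ just aₙ × ¬ (aₙ ≡ 0)) × value b ds ≡ m

-- antipalindromic: a_j = b - 1 - a_{n-j} for all j, i.e. the digit list equals
-- the reversed list with each digit a replaced by (b - 1) - a
Antipalindromic : ℕ → ℕ → Set
Antipalindromic b m =
  Σ (List ℕ) λ ds → IsBaseExpansion b m ds × ds ≡ map (λ a → (b ∸ 1) ∸ a) (reverse ds)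

-- The lowest base-3 digit of an antipalindromic number is 2 minus its leading digit,
-- which is 1 or 2. A lowest digit 0 makes p a proper multiple of 3, impossible for a
-- prime; so p ≡ 1 (mod 3), and since p is then odd, p ≡ 1 (mod 6).
module Submission where

open import Defs
open import Data.Nat using (ℕ; zero; suc; _+_; _*_; _∸_; _≤_; _<_; s≤s; z≤n)
open import Data.Nat.Properties
  using (module ≤-Reasoning; m<m*n; 0∸n≡0; *-distribˡ-+; ≤-trans; m≤m+n; m≤n*m; m≤n+m)
open import Data.Nat.Divisibility using (m∣m*n)
open import Data.Nat.Primality using (Prime; prime; composite)
open import Data.Nat.Tactic.RingSolver using (solve-∀)
open import Data.List using (List; []; _∷_; [_]; _∷ʳ_; reverse; map; head; last; initLast; _∷ʳ′_)
open import Data.List.Properties using (reverse-++; head-map)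
open import Data.Maybe as Maybe using (just)
open import Data.Maybe.Properties using (just-injective)
open import Data.Product using (∃; _,_)
open import Data.Sum using (_⊎_; inj₁; inj₂)
open import Data.Empty using (⊥-elim)
open import Relation.Nullary using (¬_)
open import Relation.Binary.PropositionalEquality using (_≡_; refl; sym; trans; cong; subst; module ≡-Reasoning)

private variable
  A : Set
  a b : ℕ

last-∷ʳ : (xs : List A) (x : A) → last (xs ∷ʳ x) ≡ just x
last-∷ʳ []           x = refl
last-∷ʳ (y ∷ [])     x = refl
last-∷ʳ (y ∷ z ∷ zs) x = last-∷ʳ (z ∷ zs) x

head-reverse : (xs : List A) → head (reverse xs) ≡ last xs
head-reverse xs with initLast xs
... | []       = refl
... | ys ∷ʳ′ x = begin
  head (reverse (ys ∷ʳ x)) ≡⟨ cong head (reverse-++ ys [ x ]) ⟩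
  just x                   ≡⟨ sym (last-∷ʳ ys x) ⟩
  last (ys ∷ʳ x)           ∎
  where open ≡-Reasoning

head-antipalindrome : (f : A → A) (xs : List A) → xs ≡ map f (reverse xs) →
                      head xs ≡ Maybe.map f (last xs)
head-antipalindrome f xs xs≡ = begin
  head xs                         ≡⟨ cong head xs≡ ⟩
  head (map f (reverse xs))       ≡⟨ head-map (reverse xs) ⟩
  Maybe.map f (head (reverse xs)) ≡⟨ cong (Maybe.map f) (head-reverse xs) ⟩
  Maybe.map f (last xs)           ∎
  where open ≡-Reasoning

lowestDigit-antipalindrome : (f : A → A) (xs : List A) {x : A} →
                             xs ≡ map f (reverse xs) → last xs ≡ just x →
                             ∃ λ ys → xs ≡ f x ∷ ys
lowestDigit-antipalindrome f [] _ ()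
lowestDigit-antipalindrome f (y ∷ ys) xs≡ last≡x
  with just-injective (trans (head-antipalindrome f (y ∷ ys) xs≡) (cong (Maybe.map f) last≡x))
... | refl = ys , refl

last-≤-value : (ds : List ℕ) → last ds ≡ just a → a ≤ value (suc b) ds
last-≤-value []           ()
last-≤-value (d ∷ [])     refl = m≤m+n d _
last-≤-value {b = b} (d ∷ e ∷ es) last≡a = begin
  _                              ≤⟨ last-≤-value (e ∷ es) last≡a ⟩
  value (suc b) (e ∷ es)         ≤⟨ m≤n*m _ (suc b) ⟩
  suc b * value (suc b) (e ∷ es) ≤⟨ m≤n+m _ d ⟩
  value (suc b) (d ∷ e ∷ es)     ∎
  where open ≤-Reasoning

¬prime-* : ∀ m n → 1 < m → 1 < n → ¬ Prime (m * n)
¬prime-* m n (s≤s (s≤s _)) 1<n (prime ¬composite) =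
  ¬composite (composite (m<m*n m n 1<n) (m∣m*n n))

even⊎odd : ∀ n → ∃ λ k → n ≡ 2 * k ⊎ n ≡ 1 + 2 * k
even⊎odd zero          = 0 , inj₁ refl
even⊎odd (suc zero)    = 0 , inj₂ refl
even⊎odd (suc (suc n)) with even⊎odd n
... | k , inj₁ refl = suc k , inj₁ (sym (*-distribˡ-+ 2 1 k))
... | k , inj₂ refl = suc k , inj₂ (cong suc (sym (*-distribˡ-+ 2 1 k)))

prime-1+3*⇒1+6* : ∀ r → Prime (1 + 3 * r) → ∃ λ k → 1 + 3 * r ≡ 6 * k + 1
prime-1+3*⇒1+6* r pr with even⊎odd r
... | k , inj₁ refl = k , 1+3*[2k]≡6k+1 k
  where
  1+3*[2k]≡6k+1 : ∀ k → 1 + 3 * (2 * k) ≡ 6 * k + 1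
  1+3*[2k]≡6k+1 = solve-∀
... | k , inj₂ refl =
  ⊥-elim (¬prime-* 2 (2 + 3 * k) (s≤s (s≤s z≤n)) (s≤s (s≤s z≤n))
           (subst Prime (1+3*[1+2k]≡2*[2+3k] k) pr))
  where
  1+3*[1+2k]≡2*[2+3k] : ∀ k → 1 + 3 * (1 + 2 * k) ≡ 2 * (2 + 3 * k)
  1+3*[1+2k]≡2*[2+3k] = solve-∀

¬prime-lowestDigit0 : (ds : List ℕ) → last (0 ∷ ds) ≡ just a → 2 ≤ a →
                      ¬ Prime (value (suc (suc b)) (0 ∷ ds))
¬prime-lowestDigit0 []       refl ()
¬prime-lowestDigit0 {b = b} (d ∷ ds) last≡a 2≤a =
  ¬prime-* (suc (suc b)) (value (suc (suc b)) (d ∷ ds)) (s≤s (s≤s z≤n))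
    (≤-trans 2≤a (last-≤-value (d ∷ ds) last≡a))

mainTheorem9 : (p : ℕ) → Prime p → Antipalindromic 3 p → ∃ λ k → p ≡ 6 * k + 1
mainTheorem9 p pp (ds , (_ , (zero , _ , a≢0) , _) , _) = ⊥-elim (a≢0 refl)
mainTheorem9 p pp (ds , (_ , (suc zero , last≡a , _) , value≡p) , anti)
  with lowestDigit-antipalindrome (2 ∸_) ds anti last≡a
... | rest , refl rewrite sym value≡p = prime-1+3*⇒1+6* (value 3 rest) pp
-- Leading digits a ≥ 3 need no separate treatment: 2 ∸ a truncates to 0 as for a = 2.
mainTheorem9 p pp (ds , (_ , (suc (suc n) , last≡a , _) , value≡p) , anti)
  with lowestDigit-antipalindrome (2 ∸_) ds anti last≡a
... | rest , refl rewrite sym value≡p | 0∸n≡0 n =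
  ⊥-elim (¬prime-lowestDigit0 rest last≡a (s≤s (s≤s z≤n)) pp)
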